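{- Let $k$ be a positive integer and $S=\{6k+1,6k+3,6k+5\}$. Then the numerical semigroup $\langle S\rangle$ is a $3$-permutation numerical semigroup.
   Context: A numerical semigroup is a submonoid $G$ of $(\mathbb{N},+,0)$ with $\mathbb{N}\setminus G$ finite; $\langle S\rangle$ is the submonoid generated by $S$. Write the elements of $G$ as $0=g_0<g_1<g_2<\cdots$. For $n\ge 1$, $G$ is an $n$-permutation numerical semigroup if $G=\langle g_1,\dots,g_n\rangle$ and for every integer $k\ge 0$ the tuple $(g_{kn+1}\bmod n,\dots,g_{kn+n}\bmod n)$ contains exactly one representative of each residue class of $\mathbb{Z}/n\mathbb{Z}$. -}

module Defs where

open import Data.Nat using (ℕ; zero; suc; _+_; _*_; _≤_; _<_; NonZero)
open import Data.Nat.DivMod using (_%_)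
open import Data.Fin using (Fin; toℕ)
open import Data.List using (List; tabulate)
open import Data.List.Membership.Propositional using (_∈_)
open import Data.Product using (Σ; ∃; ∃!; _×_)
open import Function.Bundles using (_⇔_)
open import Relation.Binary.PropositionalEquality using (_≡_)

Subsetℕ : Set₁
Subsetℕ = ℕ → Set

data ⟨_⟩ (S : List ℕ) : ℕ → Set where
  gen-zero : ⟨ S ⟩ 0
  gen-add  : ∀ {s m} → s ∈ S → ⟨ S ⟩ m → ⟨ S ⟩ (s + m)

IsSubmonoid : Subsetℕ → Set
IsSubmonoid G = G 0 × (∀ a b → G a → G b → G (a + b))

-- G is a numerical semigroup: submonoid with finite complement
-- (finite complement ⇔ there is a bound F with every m ≥ F in G).
IsNumericalSemigroup : Subsetℕ → Set
IsNumericalSemigroup G = IsSubmonoid G × ∃ λ F → ∀ m → F ≤ m → G m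

IsIncreasingEnumeration : Subsetℕ → (ℕ → ℕ) → Set
IsIncreasingEnumeration G g =
  (∀ i → g i < g (suc i)) × (∀ i → G (g i)) × (∀ m → G m → ∃ λ i → g i ≡ m)

_≐_ : Subsetℕ → Subsetℕ → Set
G ≐ H = ∀ m → G m ⇔ H m

IsPermutationNumericalSemigroup : (n : ℕ) → .{{NonZero n}} → Subsetℕ → Set
IsPermutationNumericalSemigroup n G =
  IsNumericalSemigroup G ×
  Σ (ℕ → ℕ) λ g →
    IsIncreasingEnumeration G g ×
    (G ≐ ⟨ tabulate {n = n} (λ (j : Fin n) → g (suc (toℕ j))) ⟩) ×
    (∀ (k : ℕ) (r : Fin n) →
       ∃! _≡_ (λ (j : Fin n) → g (k * n + suc (toℕ j)) % n ≡ toℕ r))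

-- Write a = 6k + 1, so that the semigroup is G = ⟨a, a + 2, a + 4⟩ = {M·a + 2j : j ≤ 2M}.
-- Cut ℕ into windows [N·a, (N + 1)·a). The members of G in window N form one of four simple
-- patterns (even offsets up to 4N; all even offsets; all offsets up to a threshold and even
-- ones beyond; all offsets), according to the size of N. Read the members of G in increasing
-- order with a small automaton that records the residues mod 3 of the current triple and fails
-- as soon as one repeats. On a run of constant pattern the automaton is periodic of period 6,
-- and a ≡ 1 mod 6, so its state at the end of window N depends only on the regime of N and on
-- N mod 3; a finite check of these cases shows that it never fails, which is precisely the
-- permutation property of the triples.

module Submission where

open import Defs
open import Data.Bool using (Bool; true; false; if_then_else_)
open import Data.Bool.Properties using (not-¬)
open import Data.Empty using (⊥-elim)
open import Data.Fin using (Fin; toℕ; punchOut; fromℕ<)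
open import Data.Fin.Patterns using (0F; 1F; 2F)
open import Data.Fin.Properties using (_≟_; punchOut-injective; injective⇒≤; any?; all?; toℕ-fromℕ<; toℕ-injective)
open import Data.List using (_∷_; []; tabulate)
open import Data.List.Membership.Propositional using (_∈_)
open import Data.List.Relation.Unary.Any using (here; there)
open import Data.Nat using (ℕ; zero; suc; _+_; _*_; _∸_; _≤_; _<_; _≤?_; NonZero; z≤n; s≤s; s≤s⁻¹; ⌊_/2⌋; parity; _%_; _/_)
open import Data.Nat.DivMod
open import Data.Nat.Divisibility using (divides)
open import Data.Nat.GeneralisedArithmetic using (fold; fold-+)
open import Data.Nat.Properties hiding (_≟_)
open import Data.Nat.Tactic.RingSolver using (solve-∀)
open import Data.Parity using (Parity; 0ℙ; 1ℙ; _⁻¹)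
import Data.Parity as ℙ
open import Data.Parity.Properties using (+-homo-+; *-homo-*; suc-homo-⁻¹; ⁻¹-selfInverse; p+p≡0ℙ)
  renaming (+-identityʳ to ℙ+-identityʳ; *-identityʳ to ℙ*-identityʳ)
open import Data.Product using (∃; ∃₂; ∃!; _×_; _,_; proj₁; proj₂)
open import Data.Sum using (inj₁; inj₂)
open import Function using (id; case_of_)
open import Function.Bundles using (mk⇔)
open import Function.Definitions using (Injective)
open import Relation.Binary using (tri<; tri≈; tri>)
open import Relation.Binary.PropositionalEquality
open import Relation.Nullary using (Dec; yes; no; does; ¬?)
open import Relation.Nullary.Decidable using (True; toWitness; dec-true; dec-false)

suc₃ : Fin 3 → Fin 3
suc₃ 0F = 1F
suc₃ 1F = 2F
suc₃ 2F = 0F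

suc₃³ : ∀ r → suc₃ (suc₃ (suc₃ r)) ≡ r
suc₃³ 0F = refl
suc₃³ 1F = refl
suc₃³ 2F = refl

[_]₃ : ℕ → Fin 3
[ zero ]₃  = 0F
[ suc n ]₃ = suc₃ [ n ]₃

_+₃_ : Fin 3 → Fin 3 → Fin 3
0F +₃ s = s
1F +₃ s = suc₃ s
2F +₃ s = suc₃ (suc₃ s)

-₃_ : Fin 3 → Fin 3
-₃ 0F = 0F
-₃ 1F = 2F
-₃ 2F = 1F

+₃-identityʳ : ∀ r → r +₃ 0F ≡ r
+₃-identityʳ 0F = refl
+₃-identityʳ 1F = refl
+₃-identityʳ 2F = refl

suc₃-+₃ : ∀ r s → suc₃ r +₃ s ≡ suc₃ (r +₃ s)
suc₃-+₃ 0F s = refl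
suc₃-+₃ 1F s = refl
suc₃-+₃ 2F s = sym (suc₃³ s)

+₃-solveˡ : ∀ r s t → r +₃ s ≡ t → r ≡ t +₃ (-₃ s)
+₃-solveˡ 0F 0F _ refl = refl
+₃-solveˡ 0F 1F _ refl = refl
+₃-solveˡ 0F 2F _ refl = refl
+₃-solveˡ 1F 0F _ refl = refl
+₃-solveˡ 1F 1F _ refl = refl
+₃-solveˡ 1F 2F _ refl = refl
+₃-solveˡ 2F 0F _ refl = refl
+₃-solveˡ 2F 1F _ refl = refl
+₃-solveˡ 2F 2F _ refl = refl

[+]₃ : ∀ m n → [ m + n ]₃ ≡ [ m ]₃ +₃ [ n ]₃
[+]₃ zero    n = refl
[+]₃ (suc m) n = trans (cong suc₃ ([+]₃ m n)) (sym (suc₃-+₃ [ m ]₃ [ n ]₃))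

[*3]₃ : ∀ n → [ n * 3 ]₃ ≡ 0F
[*3]₃ zero    = refl
[*3]₃ (suc n) = trans (suc₃³ [ n * 3 ]₃) ([*3]₃ n)

[+*3]₃ : ∀ m n → [ m + n * 3 ]₃ ≡ [ m ]₃
[+*3]₃ m n = trans ([+]₃ m (n * 3)) (trans (cong ([ m ]₃ +₃_) ([*3]₃ n)) (+₃-identityʳ [ m ]₃))

residue-via : ∀ {m} r q → m ≡ r + q * 3 → [ m ]₃ ≡ [ r ]₃
residue-via r q eq = trans (cong [_]₃ eq) ([+*3]₃ r q)

%3≡[]₃ : ∀ n → n % 3 ≡ toℕ [ n ]₃
%3≡[]₃ 0 = refl
%3≡[]₃ 1 = refl
%3≡[]₃ 2 = refl
%3≡[]₃ (suc (suc (suc n))) = begin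
  (3 + n) % 3        ≡⟨ cong (_% 3) (+-comm 3 n) ⟩
  (n + 3) % 3        ≡⟨ [m+n]%n≡m%n n 3 ⟩
  n % 3              ≡⟨ %3≡[]₃ n ⟩
  toℕ [ n ]₃         ≡⟨ cong toℕ (sym (suc₃³ [ n ]₃)) ⟩
  toℕ [ 3 + n ]₃     ∎
  where open ≡-Reasoning

parity-cases : ∀ {P : Parity → Set} t → (parity t ≡ 0ℙ → P 0ℙ) → (parity t ≡ 1ℙ → P 1ℙ) → P (parity t)
parity-cases t even odd with parity t
... | 0ℙ = even refl
... | 1ℙ = odd refl

odd⇒positive : ∀ n → parity n ≡ 1ℙ → 1 ≤ n
odd⇒positive (suc n) _ = s≤s z≤n

parity-double : ∀ n → parity (n + n) ≡ 0ℙ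
parity-double n = trans (+-homo-+ n n) (p+p≡0ℙ (parity n))

even⇒half+half : ∀ t → parity t ≡ 0ℙ → t ≡ ⌊ t /2⌋ + ⌊ t /2⌋
even⇒half+half zero          _ = refl
even⇒half+half (suc (suc t)) e = cong suc (trans (cong suc (even⇒half+half t e)) (sym (+-suc ⌊ t /2⌋ ⌊ t /2⌋)))

odd⇒1+half+half : ∀ t → parity t ≡ 1ℙ → t ≡ suc (⌊ t /2⌋ + ⌊ t /2⌋)
odd⇒1+half+half (suc zero)    _ = refl
odd⇒1+half+half (suc (suc t)) o =
  cong suc (trans (cong suc (odd⇒1+half+half t o)) (cong suc (sym (+-suc ⌊ t /2⌋ ⌊ t /2⌋))))

even-neighbours : ∀ {m n} → parity m ≡ 0ℙ → parity n ≡ 0ℙ → m ≤ n → n < 2 + m → m ≡ n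
even-neighbours {m} {n} pm pn m≤n n<2+m with m≤n⇒m<n∨m≡n m≤n
... | inj₂ m≡n = m≡n
... | inj₁ m<n with () ← trans (sym pn) (trans (cong parity (≤-antisym (s≤s⁻¹ n<2+m) m<n))
                                               (trans (sym (⁻¹-selfInverse (suc-homo-⁻¹ m))) (cong _⁻¹ pm)))

crt : Parity → Fin 3 → ℕ
crt 0ℙ 0F = 0
crt 0ℙ 1F = 4
crt 0ℙ 2F = 2
crt 1ℙ 0F = 3
crt 1ℙ 1F = 1
crt 1ℙ 2F = 5

%6≡crt : ∀ m → m % 6 ≡ crt (parity m) [ m ]₃
%6≡crt 0 = refl
%6≡crt 1 = refl
%6≡crt 2 = refl
%6≡crt 3 = refl
%6≡crt 4 = refl
%6≡crt 5 = refl
%6≡crt (suc (suc (suc (suc (suc (suc m)))))) = begin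
  (6 + m) % 6                       ≡⟨ cong (_% 6) (+-comm 6 m) ⟩
  (m + 6) % 6                       ≡⟨ [m+n]%n≡m%n m 6 ⟩
  m % 6                             ≡⟨ %6≡crt m ⟩
  crt (parity m) [ m ]₃             ≡⟨ cong (crt (parity m)) (sym (trans (suc₃³ _) (suc₃³ [ m ]₃))) ⟩
  crt (parity (6 + m)) [ 6 + m ]₃   ∎
  where open ≡-Reasoning

injective⇒∃! : ∀ {n} {f : Fin n → Fin n} → Injective _≡_ _≡_ f → ∀ r → ∃! _≡_ (λ i → f i ≡ r)
injective⇒∃! {suc m} {f} f-inj r with any? (λ i → f i ≟ r)
... | yes (i , fi≡r) = i , fi≡r , λ fj≡r → f-inj (trans fi≡r (sym fj≡r))
... | no ∄i = ⊥-elim (1+n≰n (injective⇒≤ avoid-injective))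
  where
    avoid : Fin (suc m) → Fin m
    avoid i = punchOut {i = r} (λ r≡fi → ∄i (i , sym r≡fi))
    avoid-injective : Injective _≡_ _≡_ avoid
    avoid-injective eq = f-inj (punchOut-injective {i = r} _ _ eq)

distinct⇒injective : ∀ {f : Fin 3 → Fin 3} → f 0F ≢ f 1F → f 0F ≢ f 2F → f 1F ≢ f 2F →
  Injective _≡_ _≡_ f
distinct⇒injective _   _   _   {0F} {0F} _ = refl
distinct⇒injective d01 _   _   {0F} {1F} e = ⊥-elim (d01 e)
distinct⇒injective _   d02 _   {0F} {2F} e = ⊥-elim (d02 e)
distinct⇒injective d01 _   _   {1F} {0F} e = ⊥-elim (d01 (sym e))
distinct⇒injective _   _   _   {1F} {1F} _ = refl
distinct⇒injective _   _   d12 {1F} {2F} e = ⊥-elim (d12 e)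
distinct⇒injective _   d02 _   {2F} {0F} e = ⊥-elim (d02 (sym e))
distinct⇒injective _   _   d12 {2F} {1F} e = ⊥-elim (d12 (sym e))
distinct⇒injective _   _   _   {2F} {2F} _ = refl

fold-periodic : ∀ {A : Set} {f : A → A} {c : A} {n} → fold c f n ≡ c → ∀ q → fold c f (q * n) ≡ c
fold-periodic                 period zero    = refl
fold-periodic {f = f} {c} {n} period (suc q) =
  trans (fold-+ c f n) (trans (cong (λ x → fold x f n) (fold-periodic period q)) period)

fold-mod : ∀ {A : Set} {f : A → A} {c : A} n .{{_ : NonZero n}} →
  fold c f n ≡ c → ∀ m → fold c f m ≡ fold c f (m % n)
fold-mod {f = f} {c} n period m = begin
  fold c f m                                ≡⟨ cong (fold c f) (m≡m%n+[m/n]*n m n) ⟩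
  fold c f (m % n + (m / n) * n)            ≡⟨ fold-+ c f (m % n) ⟩
  fold (fold c f ((m / n) * n)) f (m % n)   ≡⟨ cong (λ x → fold x f (m % n)) (fold-periodic period (m / n)) ⟩
  fold c f (m % n)                          ∎
  where open ≡-Reasoning

fold-crt : ∀ {A : Set} {f : A → A} {c : A} {L q r} → fold c f 6 ≡ c → parity L ≡ q → [ L ]₃ ≡ r →
  fold c f L ≡ fold c f (crt q r)
fold-crt {f = f} {c} {L} period refl refl = trans (fold-mod 6 period L) (cong (fold c f) (%6≡crt L))

periodic-invariant : ∀ {A : Set} {f : A → A} {c : A} (P : A → Set) n .{{_ : NonZero n}} →
  fold c f n ≡ c → (∀ (i : Fin n) → P (fold c f (toℕ i))) → ∀ m → P (fold c f m)
periodic-invariant {f = f} {c} P n period init m =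
  subst P (sym (fold-mod n period m))
    (subst (λ j → P (fold c f j)) (toℕ-fromℕ< (m%n<n m n)) (init (fromℕ< (m%n<n m n))))

-- The triple automaton

-- one r: the current triple has so far the residue r; two r: it has two residues, r is missing.
data Phase : Set where
  empty : Phase
  one   : Fin 3 → Phase
  two   : Fin 3 → Phase
  clash : Phase

third : Fin 3 → Fin 3 → Fin 3
third r s = -₃ (r +₃ s)

feed : Phase → Fin 3 → Phase
feed empty   r = one r
feed (one s) r = if does (s ≟ r) then clash else two (third s r)
feed (two s) r = if does (s ≟ r) then empty else clash
feed clash   _ = clash

third-distinct : ∀ {r s} → r ≢ s → third r s ≢ r × third r s ≢ s
third-distinct {0F} {0F} r≢s = ⊥-elim (r≢s refl)
third-distinct {0F} {1F} _   = (λ ()) , (λ ())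
third-distinct {0F} {2F} _   = (λ ()) , (λ ())
third-distinct {1F} {0F} _   = (λ ()) , (λ ())
third-distinct {1F} {1F} r≢s = ⊥-elim (r≢s refl)
third-distinct {1F} {2F} _   = (λ ()) , (λ ())
third-distinct {2F} {0F} _   = (λ ()) , (λ ())
third-distinct {2F} {1F} _   = (λ ()) , (λ ())
third-distinct {2F} {2F} r≢s = ⊥-elim (r≢s refl)

feed³-≢clash : ∀ r₀ r₁ r₂ → feed (feed (feed empty r₀) r₁) r₂ ≢ clash →
  feed (feed (feed empty r₀) r₁) r₂ ≡ empty × r₀ ≢ r₁ × r₀ ≢ r₂ × r₁ ≢ r₂
feed³-≢clash r₀ r₁ r₂ ok with r₀ ≟ r₁
... | yes _ = ⊥-elim (ok refl)
... | no r₀≢r₁ with third r₀ r₁ ≟ r₂ | third-distinct r₀≢r₁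
...   | yes refl | t≢r₀ , t≢r₁ = refl , r₀≢r₁ , (λ e → t≢r₀ (sym e)) , (λ e → t≢r₁ (sym e))
...   | no _     | _           = ⊥-elim (ok refl)

-- The phase, the residue of the number about to be read, and the parity of its offset in its window.
Config : Set
Config = Phase × Fin 3 × Parity

tick : (Parity → Bool) → Config → Config
tick π (σ , ρ , q) = (if π q then feed σ ρ else σ) , suc₃ ρ , q ⁻¹

every evenOnly nothing : Parity → Bool
every    _  = true
evenOnly 0ℙ = true
evenOnly 1ℙ = false
nothing  _  = false

Safe : (Parity → Bool) → Config → Set
Safe π c = ∀ L → proj₁ (fold c (tick π) L) ≢ clash

clash? : ∀ σ → Dec (σ ≡ clash)
clash? empty   = no λ ()
clash? (one _) = no λ ()
clash? (two _) = no λ ()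
clash? clash   = yes refl

safe-by-period : ∀ {π c} → fold c (tick π) 6 ≡ c →
  True (all? λ (i : Fin 6) → ¬? (clash? (proj₁ (fold c (tick π) (toℕ i))))) → Safe π c
safe-by-period period check = periodic-invariant (λ c → proj₁ c ≢ clash) 6 period (toWitness check)

nothing-keeps-phase : ∀ c L → proj₁ (fold c (tick nothing) L) ≡ proj₁ c
nothing-keeps-phase c zero    = refl
nothing-keeps-phase c (suc L) = nothing-keeps-phase c L

safe-nothing : ∀ {c} → proj₁ c ≢ clash → Safe nothing c
safe-nothing {c} ok L = subst (_≢ clash) (sym (nothing-keeps-phase c L)) ok

-- Reading the members of a decidable subset of ℕ in increasing order

module Members (p : ℕ → Bool) where

  NextMember : ℕ → ℕ → Set
  NextMember x y = p y ≡ true × x < y × (∀ z → x < z → z < y → p z ≡ false)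

  next-unique : ∀ {x y y′} → NextMember x y → NextMember x y′ → y ≡ y′
  next-unique {y = y} {y′} (py , x<y , gap) (py′ , x<y′ , gap′) with <-cmp y y′
  ... | tri< y<y′ _ _ = ⊥-elim (not-¬ py (gap′ y x<y y<y′))
  ... | tri≈ _ y≡y′ _ = y≡y′
  ... | tri> _ _ y′<y = ⊥-elim (not-¬ py′ (gap y′ x<y′ y′<y))

  firstFrom : ℕ → ℕ → ℕ
  firstFrom x zero    = x
  firstFrom x (suc f) = if p x then x else firstFrom (suc x) f

  firstFrom-spec : ∀ f x → p (f + x) ≡ true →
    p (firstFrom x f) ≡ true × x ≤ firstFrom x f × (∀ z → x ≤ z → z < firstFrom x f → p z ≡ false)
  firstFrom-spec zero    x px = px , ≤-refl , λ z x≤z z<x → ⊥-elim (<⇒≱ z<x x≤z)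
  firstFrom-spec (suc f) x pfx with p x in px
  ... | true  = px , ≤-refl , λ z x≤z z<x → ⊥-elim (<⇒≱ z<x x≤z)
  ... | false with firstFrom-spec f (suc x) (trans (cong p (+-suc f x)) pfx)
  ...   | py , x<y , gap = py , ≤-trans (n≤1+n x) x<y , gap′
    where
      gap′ : ∀ z → x ≤ z → z < firstFrom (suc x) f → p z ≡ false
      gap′ z x≤z z<y with m≤n⇒m<n∨m≡n x≤z
      ... | inj₁ x<z  = gap z x<z z<y
      ... | inj₂ refl = px

  -- The phase after reading the members below x. Starting from two 0F, reading the member 0
  -- completes a fictitious triple, so the genuine triples begin with the first positive member.
  scan : ℕ → Phase
  scan zero    = two 0F
  scan (suc x) = if p x then feed (scan x) [ x ]₃ else scan x

  scan-skip : ∀ {x} d → (∀ i → i < d → p (i + x) ≡ false) → scan (d + x) ≡ scan x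
  scan-skip zero    _    = refl
  scan-skip (suc d) none rewrite none d ≤-refl = scan-skip d (λ i i<d → none i (m≤n⇒m≤1+n i<d))

  scan-next : ∀ {x y} → NextMember x y → scan (suc y) ≡ feed (scan (suc x)) [ y ]₃
  scan-next {x} {y} (py , x<y , gap) rewrite py = cong (λ σ → feed σ [ y ]₃) (begin
    scan y                        ≡⟨ cong scan (sym (m∸n+n≡m x<y)) ⟩
    scan ((y ∸ suc x) + suc x)    ≡⟨ scan-skip (y ∸ suc x) skipped ⟩
    scan (suc x)                  ∎)
    where
      open ≡-Reasoning
      skipped : ∀ i → i < y ∸ suc x → p (i + suc x) ≡ false
      skipped i i<d = gap (i + suc x) (m≤n+m (suc x) i) (subst (i + suc x <_) (m∸n+n≡m x<y) (+-monoˡ-< (suc x) i<d))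

  config : ℕ → ℕ → Config
  config B t = scan (t + B) , [ t + B ]₃ , parity t

  tick-config : ∀ {π B} t → p (t + B) ≡ π (parity t) → tick π (config B t) ≡ config B (suc t)
  tick-config {π} {B} t member =
    cong₂ (λ b q → (if b then feed (scan (t + B)) [ t + B ]₃ else scan (t + B)) , suc₃ [ t + B ]₃ , q)
      (sym member) (⁻¹-selfInverse (suc-homo-⁻¹ t))

  record Segment (π : Parity → Bool) (B t₀ L : ℕ) : Set where
    constructor segment
    field membership : ∀ i → i < L → p (t₀ + i + B) ≡ π (parity (t₀ + i))
  open Segment

  segment-prefix : ∀ {π B t₀ L i} → Segment π B t₀ L → i ≤ L → Segment π B t₀ i
  segment-prefix seg i≤L = segment λ j j<i → membership seg j (<-≤-trans j<i i≤L)

  scan-follows : ∀ {π B t₀} L → Segment π B t₀ L → fold (config B t₀) (tick π) L ≡ config B (t₀ + L)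
  scan-follows {t₀ = t₀} zero    _   = cong (config _) (sym (+-identityʳ t₀))
  scan-follows {π} {B} {t₀} (suc L) seg = begin
    tick π (fold (config B t₀) (tick π) L) ≡⟨ cong (tick π) (scan-follows L (segment-prefix seg (n≤1+n L))) ⟩
    tick π (config B (t₀ + L))              ≡⟨ tick-config {π} (t₀ + L) (membership seg L ≤-refl) ⟩
    config B (suc (t₀ + L))                 ≡⟨ cong (config B) (sym (+-suc t₀ L)) ⟩
    config B (t₀ + suc L)                   ∎
    where open ≡-Reasoning

  two-segments : ∀ {π₁ π₂ B L₁ L₂} → Segment π₁ B 0 L₁ → Segment π₂ B L₁ L₂ →
    Safe π₁ (config B 0) → Safe π₂ (fold (config B 0) (tick π₁) L₁) →
    (∀ t → t ≤ L₁ + L₂ → scan (t + B) ≢ clash) ×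
    scan (L₁ + L₂ + B) ≡ proj₁ (fold (fold (config B 0) (tick π₁) L₁) (tick π₂) L₂)
  two-segments {π₁} {π₂} {B} {L₁} {L₂} seg₁ seg₂ safe₁ safe₂ = safe , cong proj₁ (sym (after L₂ ≤-refl))
    where
      after : ∀ i → i ≤ L₂ → fold (fold (config B 0) (tick π₁) L₁) (tick π₂) i ≡ config B (L₁ + i)
      after i i≤L₂ = trans (cong (λ c → fold c (tick π₂) i) (scan-follows L₁ seg₁))
                           (scan-follows i (segment-prefix seg₂ i≤L₂))
      safe : ∀ t → t ≤ L₁ + L₂ → scan (t + B) ≢ clash
      safe t t≤L with t ≤? L₁
      ... | yes t≤L₁ = subst (_≢ clash) (cong proj₁ (scan-follows t (segment-prefix seg₁ t≤L₁))) (safe₁ t)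
      ... | no t≰L₁ = subst (_≢ clash) (cong (λ u → scan (u + B)) (m+[n∸m]≡n L₁≤t))
                        (subst (_≢ clash) (cong proj₁ (after (t ∸ L₁) i≤L₂)) (safe₂ (t ∸ L₁)))
        where
          L₁≤t = <⇒≤ (≰⇒> t≰L₁)
          i≤L₂ = m≤n+o⇒m∸n≤o t L₁ t≤L

  module Enumeration (p-0 : p 0 ≡ true) (d : ℕ) (p-step : ∀ {x} → p x ≡ true → p (d + suc x) ≡ true) where

    next : ℕ → ℕ
    next x = firstFrom (suc x) d

    next-spec : ∀ {x} → p x ≡ true → NextMember x (next x)
    next-spec px = firstFrom-spec d _ (p-step px)

    enum : ℕ → ℕ
    enum zero    = 0
    enum (suc i) = next (enum i)

    enum-member : ∀ i → p (enum i) ≡ true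
    enum-member zero    = p-0
    enum-member (suc i) = proj₁ (next-spec (enum-member i))

    enum-next : ∀ i → NextMember (enum i) (enum (suc i))
    enum-next i = next-spec (enum-member i)

    enum-< : ∀ i → enum i < enum (suc i)
    enum-< i = proj₁ (proj₂ (enum-next i))

    i≤enum : ∀ i → i ≤ enum i
    i≤enum zero    = z≤n
    i≤enum (suc i) = ≤-trans (s≤s (i≤enum i)) (enum-< i)

    enum-covers : ∀ {x} i → p x ≡ true → x ≤ enum i → ∃ λ j → enum j ≡ x
    enum-covers zero        _  x≤0 = 0 , sym (n≤0⇒n≡0 x≤0)
    enum-covers {x} (suc i) px x≤e with x ≤? enum i
    ... | yes x≤eᵢ = enum-covers i px x≤eᵢ
    ... | no x≰eᵢ with m≤n⇒m<n∨m≡n x≤e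
    ...   | inj₂ x≡e = suc i , sym x≡e
    ...   | inj₁ x<e = ⊥-elim (not-¬ px (proj₂ (proj₂ (enum-next i)) x (≰⇒> x≰eᵢ) x<e))

    enum-surjective : ∀ {x} → p x ≡ true → ∃ λ i → enum i ≡ x
    enum-surjective {x} px = enum-covers x px (i≤enum x)

    scan-enum : ∀ i → scan (suc (enum (suc i))) ≡ feed (scan (suc (enum i))) [ enum (suc i) ]₃
    scan-enum i = scan-next (enum-next i)

    module _ (no-clash : ∀ x → scan x ≢ clash) where

      triple-step : ∀ m → scan (suc (enum m)) ≡ empty →
        scan (suc (enum (3 + m))) ≡ empty ×
        Injective _≡_ _≡_ (λ (j : Fin 3) → [ enum (suc (toℕ j) + m) ]₃)
      triple-step m start = trans read-triple closes , distinct⇒injective r₀≢r₁ r₀≢r₂ r₁≢r₂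
        where
          r : Fin 3 → Fin 3
          r j = [ enum (suc (toℕ j) + m) ]₃
          read : Phase → Phase
          read σ = feed (feed (feed σ (r 0F)) (r 1F)) (r 2F)
          read-triple : scan (suc (enum (3 + m))) ≡ read empty
          read-triple = begin
            scan (suc (enum (3 + m)))                             ≡⟨ scan-enum (2 + m) ⟩
            feed (scan (suc (enum (2 + m)))) (r 2F)               ≡⟨ cong (λ σ → feed σ (r 2F)) (scan-enum (1 + m)) ⟩
            feed (feed (scan (suc (enum (1 + m)))) (r 1F)) (r 2F) ≡⟨ cong (λ σ → feed (feed σ (r 1F)) (r 2F)) (scan-enum m) ⟩
            read (scan (suc (enum m)))                            ≡⟨ cong read start ⟩
            read empty                                            ∎
            where open ≡-Reasoning
          outcome = feed³-≢clash (r 0F) (r 1F) (r 2F) (λ eq → no-clash _ (trans read-triple eq))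
          closes = proj₁ outcome
          r₀≢r₁ = proj₁ (proj₂ outcome)
          r₀≢r₂ = proj₁ (proj₂ (proj₂ outcome))
          r₁≢r₂ = proj₂ (proj₂ (proj₂ outcome))

      triple-start : ∀ t → scan (suc (enum (t * 3))) ≡ empty
      triple-start zero    rewrite p-0 = refl
      triple-start (suc t) = proj₁ (triple-step (t * 3) (triple-start t))

      triple-residues : ∀ t r → ∃! _≡_ (λ (j : Fin 3) → enum (t * 3 + suc (toℕ j)) % 3 ≡ toℕ r)
      triple-residues t r with injective⇒∃! (proj₂ (triple-step (t * 3) (triple-start t))) r
      ... | j , rⱼ≡r , unique =
        j , trans (reindex j) (cong toℕ rⱼ≡r) , λ e → unique (toℕ-injective (trans (sym (reindex _)) e))
        where
          reindex : ∀ j → enum (t * 3 + suc (toℕ j)) % 3 ≡ toℕ [ enum (suc (toℕ j) + t * 3) ]₃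
          reindex j = trans (cong (λ n → enum n % 3) (+-comm (t * 3) (suc (toℕ j))))
                            (%3≡[]₃ (enum (suc (toℕ j) + t * 3)))

-- The semigroup ⟨a, a + 2, a + 4⟩

double-≤ : ∀ {s n} → s + s ≤ suc (n + n) → s ≤ n
double-≤ {zero}          _        = z≤n
double-≤ {suc s} {zero}  (s≤s le) with () ← subst (_≤ 0) (+-suc s s) le
double-≤ {suc s} {suc n} (s≤s le) =
  s≤s (double-≤ (s≤s⁻¹ (subst₂ _≤_ (+-suc s s) (cong suc (+-suc n n)) le)))

quadruple : ∀ n → 4 * n ≡ (n + n) + (n + n)
quadruple = solve-∀

[m+kn]/n≡k : ∀ {m n} k .{{_ : NonZero n}} → m < n → (m + k * n) / n ≡ k
[m+kn]/n≡k {m} {n} k m<n = trans (+-distrib-/-∣ʳ m (divides k refl)) (cong₂ _+_ (m<n⇒m/n≡0 m<n) (m*n/n≡m k n))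

[m+kn]%n≡m : ∀ {m n} k .{{_ : NonZero n}} → m < n → (m + k * n) % n ≡ m
[m+kn]%n≡m {m} {n} k m<n = trans ([m+kn]%n≡m%n m k n) (m<n⇒m%n≡m m<n)

does-true : ∀ {A : Set} (a? : Dec A) → does a? ≡ true → A
does-true (yes a) _ = a

⟨⟩-+ : ∀ {S m n} → ⟨ S ⟩ m → ⟨ S ⟩ n → ⟨ S ⟩ (m + n)
⟨⟩-+             gen-zero                  y = y
⟨⟩-+ {S} {n = n} (gen-add {s} {m} s∈S x) y = subst ⟨ S ⟩ (sym (+-assoc s m n)) (gen-add s∈S (⟨⟩-+ x y))

⟨⟩-isSubmonoid : ∀ S → IsSubmonoid ⟨ S ⟩
⟨⟩-isSubmonoid S = gen-zero , λ _ _ → ⟨⟩-+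

module ThreeGenerators (a : ℕ) where

  G : ℕ → Set
  G = ⟨ a ∷ 2 + a ∷ 4 + a ∷ [] ⟩

  combination∈G : ∀ M j → j ≤ M + M → G (j + j + M * a)
  combination∈G zero    zero          _  = gen-zero
  combination∈G (suc M) zero          _  = gen-add (here refl) (combination∈G M 0 z≤n)
  combination∈G (suc M) (suc zero)    _  = gen-add (there (here refl)) (combination∈G M 0 z≤n)
  combination∈G (suc M) (suc (suc j)) j≤ =
    subst G (shift j M a) (gen-add (there (there (here refl))) (combination∈G M j j≤′))
    where
      j≤′ : j ≤ M + M
      j≤′ = s≤s⁻¹ (s≤s⁻¹ (subst (suc (suc j) ≤_) (cong suc (+-suc M M)) j≤))
      shift : ∀ j M a → 4 + a + (j + j + M * a) ≡ 2 + j + (2 + j) + (1 + M) * a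
      shift = solve-∀

  ∈G⇒combination : ∀ {x} → G x → ∃₂ λ M j → j ≤ M + M × x ≡ j + j + M * a
  ∈G⇒combination gen-zero = 0 , 0 , z≤n , refl
  ∈G⇒combination (gen-add (here refl) x) with ∈G⇒combination x
  ... | M , j , j≤ , refl = suc M , j , ≤-trans j≤ (+-mono-≤ (n≤1+n M) (n≤1+n M)) , eq j M a
    where eq : ∀ j M a → a + (j + j + M * a) ≡ j + j + (1 + M) * a
          eq = solve-∀
  ∈G⇒combination (gen-add (there (here refl)) x) with ∈G⇒combination x
  ... | M , j , j≤ , refl = suc M , suc j , s≤s (≤-trans j≤ (+-monoʳ-≤ M (n≤1+n M))) , eq j M a
    where eq : ∀ j M a → 2 + a + (j + j + M * a) ≡ (1 + j) + (1 + j) + (1 + M) * a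
          eq = solve-∀
  ∈G⇒combination (gen-add (there (there (here refl))) x) with ∈G⇒combination x
  ... | M , j , j≤ , refl = suc M , suc (suc j) , s≤s (subst (suc j ≤_) (sym (+-suc M M)) (s≤s j≤)) , eq j M a
    where eq : ∀ j M a → 4 + a + (j + j + M * a) ≡ (2 + j) + (2 + j) + (1 + M) * a
          eq = solve-∀

module OddGenerator (h : ℕ) where

  a : ℕ
  a = suc (h + h)

  open ThreeGenerators a public

  -- t + N·a (t < a) lies in G iff it is j + j + M·a with j ≤ 2M: for even t take M = N and
  -- j + j = t, for odd t take M = N - 1 and j + j = t + a, hence the shift 4 + a. The bound
  -- 4N + 1 instead of 4N is equivalent (the left side is even) and spares parity arguments later.
  lift : Parity → ℕ
  lift 0ℙ = 0
  lift 1ℙ = 4 + a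

  inWindow : ℕ → ℕ → Bool
  inWindow N t = does (t + lift (parity t) ≤? suc (4 * N))

  inWindow-true : ∀ {N t π} → parity t ≡ π → t + lift π ≤ suc (4 * N) → inWindow N t ≡ true
  inWindow-true refl = dec-true (_ ≤? _)

  inWindow-false : ∀ {N t π} → parity t ≡ π → suc (4 * N) < t + lift π → inWindow N t ≡ false
  inWindow-false refl gt = dec-false (_ ≤? _) (<⇒≱ gt)

  parity-a : parity a ≡ 1ℙ
  parity-a = trans (sym (⁻¹-selfInverse (suc-homo-⁻¹ (h + h)))) (cong _⁻¹ (parity-double h))

  inWindow⇒∈G : ∀ N t → inWindow N t ≡ true → G (t + N * a)
  inWindow⇒∈G N t w with parity t in e | does-true (t + lift (parity t) ≤? suc (4 * N)) w
  ... | 0ℙ | bound = subst (λ u → G (u + N * a)) (sym (even⇒half+half t e)) (combination∈G N s (double-≤ s+s≤))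
    where
      s = ⌊ t /2⌋
      s+s≤ : s + s ≤ suc ((N + N) + (N + N))
      s+s≤ = subst₂ _≤_ (trans (+-identityʳ t) (even⇒half+half t e)) (cong suc (quadruple N)) bound
  ... | 1ℙ | bound with N
  ...   | zero  with () ← s≤s⁻¹ (≤-trans (m≤n+m (4 + a) t) bound)
  ...   | suc M = subst G (sym (trans (cong (_+ suc M * a) (odd⇒1+half+half t e)) (shift s h M)))
                    (combination∈G M j (double-≤ (+-cancelˡ-≤ 4 _ _ (subst₂ _≤_ (lhs s h) (rhs M) bound′))))
    where
      s = ⌊ t /2⌋
      j = s + suc h
      bound′ : suc (s + s) + (4 + a) ≤ suc (4 * suc M)
      bound′ = subst (λ u → u + (4 + a) ≤ suc (4 * suc M)) (odd⇒1+half+half t e) bound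
      shift : ∀ s h M → suc (s + s) + suc M * suc (h + h) ≡ (s + suc h) + (s + suc h) + M * suc (h + h)
      shift = solve-∀
      lhs : ∀ s h → suc (s + s) + (4 + suc (h + h)) ≡ 4 + ((s + suc h) + (s + suc h))
      lhs = solve-∀
      rhs : ∀ M → suc (4 * suc M) ≡ 4 + suc ((M + M) + (M + M))
      rhs = solve-∀

  even-inWindow : ∀ M e → parity e ≡ 0ℙ → e ≤ 4 * M → inWindow (M + e / a) (e % a) ≡ true
  even-inWindow M e even e≤ = parity-cases {λ _ → inWindow N r ≡ true} r
    (λ r-even → inWindow-true {N} r-even even-case)
    (λ r-odd → inWindow-true {N} r-odd (odd-case r-odd))
    where
      q = e / a
      r = e % a
      N = M + q
      split : e ≡ r + q * a
      split = m≡m%n+[m/n]*n e a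
      same-parity : parity r ℙ.+ parity q ≡ 0ℙ
      same-parity = begin
        parity r ℙ.+ parity q                  ≡⟨ cong (parity r ℙ.+_) (sym (ℙ*-identityʳ (parity q))) ⟩
        parity r ℙ.+ (parity q ℙ.* 1ℙ)         ≡⟨ cong (λ π → parity r ℙ.+ (parity q ℙ.* π)) (sym parity-a) ⟩
        parity r ℙ.+ (parity q ℙ.* parity a)   ≡⟨ cong (parity r ℙ.+_) (sym (*-homo-* q a)) ⟩
        parity r ℙ.+ parity (q * a)            ≡⟨ sym (+-homo-+ r (q * a)) ⟩
        parity (r + q * a)                     ≡⟨ cong parity (sym split) ⟩
        parity e                               ≡⟨ even ⟩
        0ℙ                                     ∎
        where open ≡-Reasoning
      even-case : r + 0 ≤ suc (4 * N)
      even-case = begin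
        r + 0              ≡⟨ +-identityʳ r ⟩
        r                  ≤⟨ m%n≤m e a ⟩
        e                  ≤⟨ e≤ ⟩
        4 * M              ≤⟨ *-monoʳ-≤ 4 (m≤m+n M q) ⟩
        4 * N              ≤⟨ n≤1+n _ ⟩
        suc (4 * N)        ∎
        where open ≤-Reasoning
      odd-case : parity r ≡ 1ℙ → r + (4 + a) ≤ suc (4 * N)
      odd-case r-odd = begin
        r + (4 + a)        ≡⟨ shuffle r a ⟩
        4 + (r + a)        ≤⟨ +-monoʳ-≤ 4 (+-monoʳ-≤ r (subst (_≤ q * a) (+-identityʳ a) (*-monoˡ-≤ a 1≤q))) ⟩
        4 + (r + q * a)    ≡⟨ cong (4 +_) (sym split) ⟩
        4 + e              ≤⟨ +-monoʳ-≤ 4 e≤ ⟩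
        4 + 4 * M          ≡⟨ sym (*-suc 4 M) ⟩
        4 * suc M          ≤⟨ *-monoʳ-≤ 4 (subst (_≤ M + q) (+-comm M 1) (+-monoʳ-≤ M 1≤q)) ⟩
        4 * N              ≤⟨ n≤1+n _ ⟩
        suc (4 * N)        ∎
        where
          open ≤-Reasoning
          shuffle : ∀ r a → r + (4 + a) ≡ 4 + (r + a)
          shuffle = solve-∀
          1≤q : 1 ≤ q
          1≤q = odd⇒positive q (sym (⁻¹-selfInverse (subst (λ π → π ℙ.+ parity q ≡ 0ℙ) r-odd same-parity)))

  member : ℕ → Bool
  member x = inWindow (x / a) (x % a)

  member-window : ∀ N {t} → t < a → member (t + N * a) ≡ inWindow N t
  member-window N t<a = cong₂ inWindow ([m+kn]/n≡k N t<a) ([m+kn]%n≡m N t<a)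

  member⇒∈G : ∀ {x} → member x ≡ true → G x
  member⇒∈G {x} m = subst G (sym (m≡m%n+[m/n]*n x a)) (inWindow⇒∈G (x / a) (x % a) m)

  ∈G⇒member : ∀ {x} → G x → member x ≡ true
  ∈G⇒member gx with ∈G⇒combination gx
  ... | M , j , j≤ , refl = trans (cong member x≡) (trans (member-window (M + q) (m%n<n (j + j) a))
      (even-inWindow M (j + j) (parity-double j) (subst (j + j ≤_) (sym (quadruple M)) (+-mono-≤ j≤ j≤))))
    where
      q = (j + j) / a
      regroup : ∀ r q M a → r + q * a + M * a ≡ r + (M + q) * a
      regroup = solve-∀
      x≡ : j + j + M * a ≡ (j + j) % a + (M + q) * a
      x≡ = trans (cong (_+ M * a) (m≡m%n+[m/n]*n (j + j) a)) (regroup ((j + j) % a) q M a)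

  inWindow-full : ∀ {N t} → h < N → t < a → inWindow N t ≡ true
  inWindow-full {N} {t} h<N t<a = dec-true (_ ≤? _) (≤-trans (+-monoʳ-≤ t (lift≤ (parity t))) (begin
    t + (4 + a)            ≤⟨ +-monoˡ-≤ (4 + a) (s≤s⁻¹ t<a) ⟩
    h + h + (4 + a)        ≡⟨ eq h ⟩
    suc (4 * suc h)        ≤⟨ s≤s (*-monoʳ-≤ 4 h<N) ⟩
    suc (4 * N)            ∎))
    where
      open ≤-Reasoning
      lift≤ : ∀ π → lift π ≤ 4 + a
      lift≤ 0ℙ = z≤n
      lift≤ 1ℙ = ≤-refl
      eq : ∀ h → h + h + (4 + suc (h + h)) ≡ suc (4 * suc h)
      eq = solve-∀

  conductor : ∀ x → suc h * a ≤ x → G x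
  conductor x le =
    member⇒∈G (inWindow-full (subst (_≤ x / a) (m*n/n≡m (suc h) a) (/-monoˡ-≤ a le)) (m%n<n x a))

-- The semigroup ⟨6k + 1, 6k + 3, 6k + 5⟩

module _ (k : ℕ) (k≥1 : 1 ≤ k) where

  h : ℕ
  h = 3 * k

  open OddGenerator h
  open Members member

  3≤h : 3 ≤ h
  3≤h = *-monoʳ-≤ 3 k≥1

  3<a : 3 < a
  3<a = s≤s (≤-trans 3≤h (m≤m+n h h))

  [N*a]₃ : ∀ N → [ N * a ]₃ ≡ [ N ]₃
  [N*a]₃ N = residue-via N (N * (2 * k)) (eq N k)
    where eq : ∀ N k → N * suc (3 * k + 3 * k) ≡ N + N * (2 * k) * 3
          eq = solve-∀

  [4N]₃ : ∀ N → [ 4 * N ]₃ ≡ [ N ]₃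
  [4N]₃ N = residue-via N N (eq N)
    where eq : ∀ N → 4 * N ≡ N + N * 3
          eq = solve-∀

  [h]₃ : [ h ]₃ ≡ 0F
  [h]₃ = residue-via 0 k (eq k)
    where eq : ∀ k → 3 * k ≡ 0 + k * 3
          eq = solve-∀

  [h+h]₃ : [ h + h ]₃ ≡ 0F
  [h+h]₃ = residue-via 0 (2 * k) (eq k)
    where eq : ∀ k → 3 * k + 3 * k ≡ 0 + 2 * k * 3
          eq = solve-∀

  [h+h+4]₃ : [ h + h + 4 ]₃ ≡ 1F
  [h+h+4]₃ = residue-via 4 (2 * k) (eq k)
    where eq : ∀ k → 3 * k + 3 * k + 4 ≡ 4 + 2 * k * 3
          eq = solve-∀

  [a]₃ : [ a ]₃ ≡ 1F
  [a]₃ = cong suc₃ [h+h]₃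

  parity-4N : ∀ N → parity (4 * N) ≡ 0ℙ
  parity-4N N = *-homo-* 4 N

  parity-h+h+4 : parity (h + h + 4) ≡ 0ℙ
  parity-h+h+4 = trans (+-homo-+ (h + h) 4) (cong (ℙ._+ 0ℙ) (parity-double h))

  -- The members of G in window N, at offsets t < a:
  --   separated:   the even t ≤ 4N,
  --   touching:    all even t,
  --   overlapping: all t < 4N − (2h + 4), and the even t beyond,
  --   saturated:   all t.
  data Regime : Set where
    separated touching overlapping saturated : Regime

  data RegimeOf (N : ℕ) : Regime → Set where
    separated   : 4 * N + 2 ≤ h + h → RegimeOf N separated
    touching    : h + h < 4 * N + 2 → 4 * N ≤ h + h + 4 → RegimeOf N touching
    overlapping : h + h + 4 < 4 * N → N ≤ h → RegimeOf N overlapping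
    saturated   : h < N → RegimeOf N saturated

  regimeOf : ∀ N → ∃ (RegimeOf N)
  regimeOf N with 4 * N + 2 ≤? h + h | 4 * N ≤? h + h + 4 | N ≤? h
  ... | yes sep | _       | _      = separated , separated sep
  ... | no ¬sep | yes tch | _      = touching , touching (≰⇒> ¬sep) tch
  ... | no _    | no ¬tch | yes ≤h = overlapping , overlapping (≰⇒> ¬tch) ≤h
  ... | no _    | no _    | no >h  = saturated , saturated (≰⇒> >h)

  even-inside : ∀ {N t} → parity t ≡ 0ℙ → t ≤ suc (4 * N) → inWindow N t ≡ true
  even-inside {N} e le = inWindow-true {N} e (subst (_≤ _) (sym (+-identityʳ _)) le)

  even-outside : ∀ {N t} → parity t ≡ 0ℙ → suc (4 * N) < t → inWindow N t ≡ false
  even-outside {N} e gt = inWindow-false {N} e (subst (_ <_) (sym (+-identityʳ _)) gt)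

  odd-outside : ∀ {N t} → 4 * N ≤ h + h + 4 → parity t ≡ 1ℙ → inWindow N t ≡ false
  odd-outside {N} {t} le e = inWindow-false {N} e (begin-strict
    suc (4 * N)          ≤⟨ s≤s le ⟩
    suc (h + h + 4)      <⟨ subst (suc (h + h + 4) <_) (eq h) (n<1+n _) ⟩
    1 + (4 + a)          ≤⟨ +-monoˡ-≤ (4 + a) (odd⇒positive t e) ⟩
    t + (4 + a)          ∎)
    where
      open ≤-Reasoning
      eq : ∀ h → suc (suc (h + h + 4)) ≡ 1 + (4 + suc (h + h))
      eq = solve-∀

  segment-in-window : ∀ {π N t₀ L} → t₀ + L ≤ a →
    (∀ t → t₀ ≤ t → t < t₀ + L → inWindow N t ≡ π (parity t)) → Segment π (N * a) t₀ L
  segment-in-window {π} {N} {t₀} bound shape = segment λ i i<L →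
    trans (member-window N (<-≤-trans (+-monoʳ-< t₀ i<L) bound)) (shape (t₀ + i) (m≤m+n t₀ i) (+-monoʳ-< t₀ i<L))

  -- The phase of the scan at N·a. In the separated regime N² members lie below N·a, whence
  -- two 0F when 3 ∣ N and empty otherwise; the other rows are what the earlier windows leave.
  startPhase : Regime → Fin 3 → Phase
  startPhase overlapping 0F = one 2F
  startPhase overlapping 2F = one 1F
  startPhase saturated   2F = one 1F
  startPhase _           0F = two 0F
  startPhase _           _  = empty

  start : Regime → Fin 3 → Config
  start r ρ = startPhase r ρ , ρ , 0ℙ

  firstPattern : Regime → Parity → Bool
  firstPattern separated   = evenOnly
  firstPattern touching    = evenOnly
  firstPattern overlapping = every
  firstPattern saturated   = every

  turn : Fin 3 → Config
  turn ρ = fold (start overlapping ρ) (tick every) (crt 0ℙ (ρ +₃ 2F))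

  -- Each window is read in at most two segments of constant pattern, of lengths 4N + 2 then the
  -- rest (separated), a (touching, saturated), or 4N − (2h + 4) then the rest (overlapping).
  -- The automaton is 6-periodic on each segment, so only the length mod 6, i.e. its parity and
  -- its residue mod 3, matters; these depend on the regime and on ρ = N mod 3 only.
  endPhase : Regime → Fin 3 → Phase
  endPhase separated   ρ = proj₁ (fold (start separated ρ) (tick evenOnly) (crt 0ℙ (ρ +₃ 2F)))
  endPhase touching    ρ = proj₁ (fold (start touching ρ) (tick evenOnly) (crt 1ℙ 1F))
  endPhase overlapping ρ = proj₁ (fold (turn ρ) (tick evenOnly) (crt 1ℙ (1F +₃ (-₃ (ρ +₃ 2F)))))
  endPhase saturated   ρ = proj₁ (fold (start saturated ρ) (tick every) (crt 1ℙ 1F))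

  start-checked : ∀ r ρ →
    fold (start r ρ) (tick (firstPattern r)) 6 ≡ start r ρ × Safe (firstPattern r) (start r ρ)
  start-checked separated   0F = refl , safe-by-period refl _
  start-checked separated   1F = refl , safe-by-period refl _
  start-checked separated   2F = refl , safe-by-period refl _
  start-checked touching    0F = refl , safe-by-period refl _
  start-checked touching    1F = refl , safe-by-period refl _
  start-checked touching    2F = refl , safe-by-period refl _
  start-checked overlapping 0F = refl , safe-by-period refl _
  start-checked overlapping 1F = refl , safe-by-period refl _
  start-checked overlapping 2F = refl , safe-by-period refl _
  start-checked saturated   0F = refl , safe-by-period refl _
  start-checked saturated   1F = refl , safe-by-period refl _
  start-checked saturated   2F = refl , safe-by-period refl _

  turn-checked : ∀ ρ → fold (turn ρ) (tick evenOnly) 6 ≡ turn ρ × Safe evenOnly (turn ρ)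
  turn-checked 0F = refl , safe-by-period refl _
  turn-checked 1F = refl , safe-by-period refl _
  turn-checked 2F = refl , safe-by-period refl _

  WindowResult : ℕ → Regime → Set
  WindowResult N r = (∀ t → t ≤ a → scan (t + N * a) ≢ clash) × scan (a + N * a) ≡ endPhase r [ N ]₃

  window-by-segments : ∀ {N r π₂ L₁ L₂} → L₁ + L₂ ≡ a → scan (N * a) ≡ startPhase r [ N ]₃ →
    Segment (firstPattern r) (N * a) 0 L₁ → Segment π₂ (N * a) L₁ L₂ →
    Safe π₂ (fold (start r [ N ]₃) (tick (firstPattern r)) L₁) →
    proj₁ (fold (fold (start r [ N ]₃) (tick (firstPattern r)) L₁) (tick π₂) L₂) ≡ endPhase r [ N ]₃ →
    WindowResult N r
  window-by-segments {N} {r} {π₂} {L₁} {L₂} L≡a s₀ seg₁ seg₂ safe₂ end =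
    subst (λ L → (∀ t → t ≤ L → scan (t + N * a) ≢ clash) × scan (L + N * a) ≡ endPhase r [ N ]₃) L≡a
      (proj₁ outcome ,
       trans (proj₂ outcome) (trans (cong (λ c → proj₁ (fold (fold c π₁ L₁) (tick π₂) L₂)) c₀≡) end))
    where
      π₁ = tick (firstPattern r)
      c₀≡ : config (N * a) 0 ≡ start r [ N ]₃
      c₀≡ = cong₂ (λ σ ρ → σ , ρ , 0ℙ) s₀ ([N*a]₃ N)
      outcome = two-segments seg₁ seg₂
        (subst (Safe (firstPattern r)) (sym c₀≡) (proj₂ (start-checked r [ N ]₃)))
        (subst (λ c → Safe π₂ (fold c π₁ L₁)) (sym c₀≡) safe₂)

  window-separated : ∀ {N} → 4 * N + 2 ≤ h + h → scan (N * a) ≡ startPhase separated [ N ]₃ →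
    WindowResult N separated
  window-separated {N} sep s₀ =
    window-by-segments {N} {separated} L₁+L₂≡a s₀
      (segment-in-window {N = N} L₁≤a low) (segment-in-window {N = N} (≤-reflexive L₁+L₂≡a) high)
      (safe-nothing (proj₂ checked L₁))
      (trans (nothing-keeps-phase _ (a ∸ L₁))
             (cong proj₁ (fold-crt {f = tick evenOnly} {L = L₁} (proj₁ checked) parity-L₁ residue-L₁)))
    where
      L₁ = 4 * N + 2
      L₁≤a : L₁ ≤ a
      L₁≤a = ≤-trans sep (n≤1+n _)
      L₁+L₂≡a = m+[n∸m]≡n L₁≤a
      4N≤ : 4 * N ≤ h + h + 4
      4N≤ = ≤-trans (m≤m+n (4 * N) 2) (≤-trans sep (m≤m+n (h + h) 4))
      low : ∀ t → 0 ≤ t → t < L₁ → inWindow N t ≡ evenOnly (parity t)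
      low t _ t<L₁ = parity-cases {λ q → inWindow N t ≡ evenOnly q} t
        (λ e → even-inside {N} {t} e (s≤s⁻¹ (subst (t <_) (+-comm (4 * N) 2) t<L₁)))
        (λ e → odd-outside {N} {t} 4N≤ e)
      high : ∀ t → L₁ ≤ t → t < L₁ + (a ∸ L₁) → inWindow N t ≡ nothing (parity t)
      high t L₁≤t _ = parity-cases {λ q → inWindow N t ≡ nothing q} t
        (λ e → even-outside {N} {t} e (subst (_≤ t) (+-comm (4 * N) 2) L₁≤t))
        (λ e → odd-outside {N} {t} 4N≤ e)
      checked = start-checked separated [ N ]₃
      parity-L₁ : parity L₁ ≡ 0ℙ
      parity-L₁ = trans (+-homo-+ (4 * N) 2) (cong (ℙ._+ 0ℙ) (parity-4N N))
      residue-L₁ : [ L₁ ]₃ ≡ [ N ]₃ +₃ 2F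
      residue-L₁ = trans ([+]₃ (4 * N) 2) (cong (_+₃ 2F) ([4N]₃ N))

  window-touching : ∀ {N} → h + h < 4 * N + 2 → 4 * N ≤ h + h + 4 → scan (N * a) ≡ startPhase touching [ N ]₃ →
    WindowResult N touching
  window-touching {N} lo hi s₀ =
    window-by-segments {N} {touching} (+-identityʳ a) s₀ (segment-in-window {N = N} ≤-refl shape) (segment λ _ ())
      (safe-nothing (proj₂ checked a)) (cong proj₁ (fold-crt {f = tick evenOnly} {L = a} (proj₁ checked) parity-a [a]₃))
    where
      shape : ∀ t → 0 ≤ t → t < a → inWindow N t ≡ evenOnly (parity t)
      shape t _ t<a = parity-cases {λ q → inWindow N t ≡ evenOnly q} t
        (λ e → even-inside {N} {t} e (≤-trans (s≤s⁻¹ t<a) (s≤s⁻¹ (subst (h + h <_) (+-comm (4 * N) 2) lo))))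
        (λ e → odd-outside {N} {t} hi e)
      checked = start-checked touching [ N ]₃

  window-saturated : ∀ {N} → h < N → scan (N * a) ≡ startPhase saturated [ N ]₃ → WindowResult N saturated
  window-saturated {N} h<N s₀ =
    window-by-segments {N} {saturated} (+-identityʳ a) s₀
      (segment-in-window {N = N} ≤-refl λ t _ t<a → inWindow-full {N} h<N t<a) (segment λ _ ())
      (safe-nothing (proj₂ checked a)) (cong proj₁ (fold-crt {f = tick every} {L = a} (proj₁ checked) parity-a [a]₃))
    where checked = start-checked saturated [ N ]₃

  module Overlapping (N : ℕ) (lo : h + h + 4 < 4 * N) (hi : N ≤ h) where

    L₁ L₂ : ℕ
    L₁ = 4 * N ∸ (h + h + 4)
    L₂ = a ∸ L₁

    split : L₁ + (h + h + 4) ≡ 4 * N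
    split = m∸n+n≡m (<⇒≤ lo)

    L₁≤a : L₁ ≤ a
    L₁≤a = ≤-trans (m≤m+n L₁ 4) (≤-trans L₁+4≤ (n≤1+n (h + h)))
      where
        open ≤-Reasoning
        regroup : ∀ L h → L + 4 + (h + h) ≡ L + (h + h + 4)
        regroup = solve-∀
        L₁+4≤ : L₁ + 4 ≤ h + h
        L₁+4≤ = +-cancelʳ-≤ (h + h) (L₁ + 4) (h + h) (begin
          L₁ + 4 + (h + h)          ≡⟨ regroup L₁ h ⟩
          L₁ + (h + h + 4)          ≡⟨ split ⟩
          4 * N                     ≤⟨ *-monoʳ-≤ 4 hi ⟩
          4 * h                     ≡⟨ quadruple h ⟩
          h + h + (h + h)           ∎)

    L₁+L₂≡a : L₁ + L₂ ≡ a
    L₁+L₂≡a = m+[n∸m]≡n L₁≤a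

    parity-L₁ : parity L₁ ≡ 0ℙ
    parity-L₁ = begin
      parity L₁                          ≡⟨ sym (ℙ+-identityʳ (parity L₁)) ⟩
      parity L₁ ℙ.+ 0ℙ                   ≡⟨ cong (parity L₁ ℙ.+_) (sym parity-h+h+4) ⟩
      parity L₁ ℙ.+ parity (h + h + 4)   ≡⟨ sym (+-homo-+ L₁ (h + h + 4)) ⟩
      parity (L₁ + (h + h + 4))          ≡⟨ cong parity split ⟩
      parity (4 * N)                     ≡⟨ parity-4N N ⟩
      0ℙ                                 ∎
      where open ≡-Reasoning

    residue-L₁ : [ L₁ ]₃ ≡ [ N ]₃ +₃ 2F
    residue-L₁ = +₃-solveˡ [ L₁ ]₃ 1F [ N ]₃ (begin
      [ L₁ ]₃ +₃ 1F                      ≡⟨ cong ([ L₁ ]₃ +₃_) (sym [h+h+4]₃) ⟩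
      [ L₁ ]₃ +₃ [ h + h + 4 ]₃          ≡⟨ sym ([+]₃ L₁ (h + h + 4)) ⟩
      [ L₁ + (h + h + 4) ]₃              ≡⟨ cong [_]₃ split ⟩
      [ 4 * N ]₃                         ≡⟨ [4N]₃ N ⟩
      [ N ]₃                             ∎)
      where open ≡-Reasoning

    parity-L₂ : parity L₂ ≡ 1ℙ
    parity-L₂ = begin
      parity L₂                          ≡⟨ cong (ℙ._+ parity L₂) (sym parity-L₁) ⟩
      parity L₁ ℙ.+ parity L₂            ≡⟨ sym (+-homo-+ L₁ L₂) ⟩
      parity (L₁ + L₂)                   ≡⟨ cong parity L₁+L₂≡a ⟩
      parity a                           ≡⟨ parity-a ⟩
      1ℙ                                 ∎
      where open ≡-Reasoning

    residue-L₂ : [ L₂ ]₃ ≡ 1F +₃ (-₃ ([ N ]₃ +₃ 2F))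
    residue-L₂ = trans (+₃-solveˡ [ L₂ ]₃ [ L₁ ]₃ 1F (begin
      [ L₂ ]₃ +₃ [ L₁ ]₃                 ≡⟨ sym ([+]₃ L₂ L₁) ⟩
      [ L₂ + L₁ ]₃                       ≡⟨ cong [_]₃ (trans (+-comm L₂ L₁) L₁+L₂≡a) ⟩
      [ a ]₃                             ≡⟨ [a]₃ ⟩
      1F                                 ∎)) (cong (λ r → 1F +₃ (-₃ r)) residue-L₁)
      where open ≡-Reasoning

    odd-shift : ∀ t → t + (4 + a) ≡ suc t + (h + h + 4)
    odd-shift t = eq t h
      where eq : ∀ t h → t + (4 + suc (h + h)) ≡ suc t + (h + h + 4)
            eq = solve-∀

    low : ∀ t → 0 ≤ t → t < L₁ → inWindow N t ≡ every (parity t)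
    low t _ t<L₁ = parity-cases {λ q → inWindow N t ≡ every q} t
      (λ e → even-inside {N} {t} e
               (≤-trans (<⇒≤ t<L₁) (≤-trans (m≤m+n L₁ _) (≤-trans (≤-reflexive split) (n≤1+n _)))))
      (λ e → inWindow-true {N} {t} e (begin
        t + (4 + a)          ≡⟨ odd-shift t ⟩
        suc t + (h + h + 4)  ≤⟨ +-monoˡ-≤ (h + h + 4) t<L₁ ⟩
        L₁ + (h + h + 4)     ≡⟨ split ⟩
        4 * N                ≤⟨ n≤1+n _ ⟩
        suc (4 * N)          ∎))
      where open ≤-Reasoning

    high : ∀ t → L₁ ≤ t → t < L₁ + L₂ → inWindow N t ≡ evenOnly (parity t)
    high t L₁≤t t<L = parity-cases {λ q → inWindow N t ≡ evenOnly q} t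
      (λ e → even-inside {N} {t} e (≤-trans (s≤s⁻¹ (subst (t <_) L₁+L₂≡a t<L)) h+h≤))
      (λ e → inWindow-false {N} {t} e (begin-strict
        suc (4 * N)              ≡⟨ cong suc (sym split) ⟩
        suc (L₁ + (h + h + 4))   <⟨ s≤s (+-monoˡ-< (h + h + 4) (L₁<t e)) ⟩
        suc t + (h + h + 4)      ≡⟨ sym (odd-shift t) ⟩
        t + (4 + a)              ∎))
      where
        open ≤-Reasoning
        h+h≤ : h + h ≤ suc (4 * N)
        h+h≤ = ≤-trans (m≤m+n (h + h) 4) (≤-trans (<⇒≤ lo) (n≤1+n _))
        L₁<t : parity t ≡ 1ℙ → L₁ < t
        L₁<t e = ≤∧≢⇒< L₁≤t (λ L₁≡t → case trans (sym parity-L₁) (trans (cong parity L₁≡t) e) of λ ())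

  window-overlapping : ∀ {N} → h + h + 4 < 4 * N → N ≤ h → scan (N * a) ≡ startPhase overlapping [ N ]₃ →
    WindowResult N overlapping
  window-overlapping {N} lo hi s₀ =
    window-by-segments {N} {overlapping} L₁+L₂≡a s₀
      (segment-in-window {N = N} L₁≤a low) (segment-in-window {N = N} (≤-reflexive L₁+L₂≡a) high)
      (subst (Safe evenOnly) (sym turned) (proj₂ (turn-checked [ N ]₃)))
      (trans (cong (λ c → proj₁ (fold c (tick evenOnly) L₂)) turned)
             (cong proj₁ (fold-crt {f = tick evenOnly} {L = L₂} (proj₁ (turn-checked [ N ]₃)) parity-L₂ residue-L₂)))
    where
      open Overlapping N lo hi
      turned : fold (start overlapping [ N ]₃) (tick every) L₁ ≡ turn [ N ]₃
      turned = fold-crt {f = tick every} {L = L₁} (proj₁ (start-checked overlapping [ N ]₃)) parity-L₁ residue-L₁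

  window : ∀ {N r} → RegimeOf N r → scan (N * a) ≡ startPhase r [ N ]₃ → WindowResult N r
  window {N} (separated sep)     = window-separated {N} sep
  window {N} (touching lo hi)    = window-touching {N} lo hi
  window {N} (overlapping lo hi) = window-overlapping {N} lo hi
  window {N} (saturated h<N)     = window-saturated {N} h<N

  data Transition : Regime → Regime → Fin 3 → Set where
    separated→separated     : ∀ {ρ} → Transition separated separated ρ
    separated→touching      : ∀ {ρ} → Transition separated touching ρ
    touching→touching       : Transition touching touching 0F
    touching→overlapping    : ∀ {ρ} → Transition touching overlapping ρ
    overlapping→overlapping : ∀ {ρ} → Transition overlapping overlapping ρ
    overlapping→saturated   : Transition overlapping saturated 0F
    saturated→saturated     : ∀ {ρ} → Transition saturated saturated ρ

  transition-phase : ∀ {r r′ ρ} → Transition r r′ ρ → endPhase r ρ ≡ startPhase r′ (suc₃ ρ)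
  transition-phase (separated→separated {0F})     = refl
  transition-phase (separated→separated {1F})     = refl
  transition-phase (separated→separated {2F})     = refl
  transition-phase (separated→touching {0F})      = refl
  transition-phase (separated→touching {1F})      = refl
  transition-phase (separated→touching {2F})      = refl
  transition-phase touching→touching              = refl
  transition-phase (touching→overlapping {0F})    = refl
  transition-phase (touching→overlapping {1F})    = refl
  transition-phase (touching→overlapping {2F})    = refl
  transition-phase (overlapping→overlapping {0F}) = refl
  transition-phase (overlapping→overlapping {1F}) = refl
  transition-phase (overlapping→overlapping {2F}) = refl
  transition-phase overlapping→saturated          = refl
  transition-phase (saturated→saturated {0F})     = refl
  transition-phase (saturated→saturated {1F})     = refl
  transition-phase (saturated→saturated {2F})     = refl

  4N+4≡4[1+N] : ∀ N → 4 * N + 4 ≡ 4 * suc N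
  4N+4≡4[1+N] = solve-∀

  4N≤4[1+N] : ∀ N → 4 * N ≤ 4 * suc N
  4N≤4[1+N] N = *-monoʳ-≤ 4 (n≤1+n N)

  N+N≤4N : ∀ N → N + N ≤ 4 * N
  N+N≤4N N = subst (N + N ≤_) (sym (quadruple N)) (m≤m+n (N + N) (N + N))

  h+h<4N : ∀ {N} → h < N → h + h < 4 * N
  h+h<4N {N} h<N = <-≤-trans (+-mono-< h<N h<N) (N+N≤4N N)

  module _ where
    open ≤-Reasoning

    from-separated : ∀ {N r′} → 4 * N + 2 ≤ h + h → RegimeOf (suc N) r′ → Transition separated r′ [ N ]₃
    from-separated _ (separated _)   = separated→separated
    from-separated _ (touching _ _)  = separated→touching
    from-separated {N} sep (overlapping lo′ _) = ⊥-elim (<-irrefl refl (begin-strict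
      4 * N + 4         ≤⟨ +-monoˡ-≤ 4 (≤-trans (m≤m+n (4 * N) 2) sep) ⟩
      h + h + 4         <⟨ lo′ ⟩
      4 * suc N         ≡⟨ 4N+4≡4[1+N] N ⟨
      4 * N + 4         ∎))
    from-separated {N} sep (saturated h<1+N) = ⊥-elim (<-irrefl refl (begin-strict
      h + h             ≤⟨ +-mono-≤ (s≤s⁻¹ h<1+N) (s≤s⁻¹ h<1+N) ⟩
      N + N             ≤⟨ N+N≤4N N ⟩
      4 * N             <⟨ m<m+n (4 * N) (s≤s z≤n) ⟩
      4 * N + 2         ≤⟨ sep ⟩
      h + h             ∎))

    from-touching : ∀ {N r′} → h + h < 4 * N + 2 → 4 * N ≤ h + h + 4 → RegimeOf (suc N) r′ →
      Transition touching r′ [ N ]₃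
    from-touching _ _ (overlapping _ _) = touching→overlapping
    from-touching {N} lo _ (touching _ hi′) = subst (Transition touching touching) (sym N≡0) touching→touching
      where
        4N≡h+h : 4 * N ≡ h + h
        4N≡h+h = even-neighbours (parity-4N N) (parity-double h)
                   (+-cancelʳ-≤ 4 (4 * N) (h + h) (subst (_≤ h + h + 4) (sym (4N+4≡4[1+N] N)) hi′))
                   (subst (h + h <_) (+-comm (4 * N) 2) lo)
        N≡0 : [ N ]₃ ≡ 0F
        N≡0 = trans (sym ([4N]₃ N)) (trans (cong [_]₃ 4N≡h+h) [h+h]₃)
    from-touching {N} lo _ (separated sep′) = ⊥-elim (<-irrefl refl (begin-strict
      h + h             <⟨ lo ⟩
      4 * N + 2         ≤⟨ +-monoˡ-≤ 2 (4N≤4[1+N] N) ⟩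
      4 * suc N + 2     ≤⟨ sep′ ⟩
      h + h             ∎))
    from-touching {N} _ hi (saturated h<1+N) = ⊥-elim (<-irrefl refl (begin-strict
      h + h + 4         <⟨ +-monoʳ-< (h + h) (≤-trans (m≤m+n 5 1) (+-mono-≤ 3≤h 3≤h)) ⟩
      h + h + (h + h)   ≡⟨ quadruple h ⟨
      4 * h             ≤⟨ *-monoʳ-≤ 4 (s≤s⁻¹ h<1+N) ⟩
      4 * N             ≤⟨ hi ⟩
      h + h + 4         ∎))

    from-overlapping : ∀ {N r′} → h + h + 4 < 4 * N → N ≤ h → RegimeOf (suc N) r′ →
      Transition overlapping r′ [ N ]₃
    from-overlapping _ _ (overlapping _ _) = overlapping→overlapping
    from-overlapping {N} _ N≤h (saturated h<1+N) =
      subst (Transition overlapping saturated) (sym (trans (cong [_]₃ (≤-antisym N≤h (s≤s⁻¹ h<1+N))) [h]₃))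
        overlapping→saturated
    from-overlapping {N} lo _ (separated sep′) = ⊥-elim (<-irrefl refl (begin-strict
      4 * N             ≤⟨ 4N≤4[1+N] N ⟩
      4 * suc N         ≤⟨ m≤m+n (4 * suc N) 2 ⟩
      4 * suc N + 2     ≤⟨ sep′ ⟩
      h + h             ≤⟨ m≤m+n (h + h) 4 ⟩
      h + h + 4         <⟨ lo ⟩
      4 * N             ∎))
    from-overlapping {N} lo _ (touching _ hi′) = ⊥-elim (<-irrefl refl (begin-strict
      4 * N             ≤⟨ 4N≤4[1+N] N ⟩
      4 * suc N         ≤⟨ hi′ ⟩
      h + h + 4         <⟨ lo ⟩
      4 * N             ∎))

    from-saturated : ∀ {N r′} → h < N → RegimeOf (suc N) r′ → Transition saturated r′ [ N ]₃
    from-saturated _ (saturated _) = saturated→saturated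
    from-saturated h<N (overlapping _ 1+N≤h) = ⊥-elim (<-irrefl refl (<-≤-trans h<N (≤-trans (n≤1+n _) 1+N≤h)))
    from-saturated {N} h<N (separated sep′) = ⊥-elim (<-irrefl refl (begin-strict
      4 * N             ≤⟨ 4N≤4[1+N] N ⟩
      4 * suc N         ≤⟨ m≤m+n (4 * suc N) 2 ⟩
      4 * suc N + 2     ≤⟨ sep′ ⟩
      h + h             <⟨ h+h<4N h<N ⟩
      4 * N             ∎))
    from-saturated {N} h<N (touching _ hi′) = ⊥-elim (<-irrefl refl (begin-strict
      4 * N + 4         ≡⟨ 4N+4≡4[1+N] N ⟩
      4 * suc N         ≤⟨ hi′ ⟩
      h + h + 4         <⟨ +-monoˡ-< 4 (h+h<4N h<N) ⟩
      4 * N + 4         ∎))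

  regime-transition : ∀ {N r r′} → RegimeOf N r → RegimeOf (suc N) r′ → Transition r r′ [ N ]₃
  regime-transition (separated sep)     = from-separated sep
  regime-transition (touching lo hi)    = from-touching lo hi
  regime-transition (overlapping lo hi) = from-overlapping lo hi
  regime-transition (saturated h<N)     = from-saturated h<N

  window-start : ∀ N {r} → RegimeOf N r → scan (N * a) ≡ startPhase r [ N ]₃
  window-start zero    (separated _)   = refl
  window-start zero    (touching lo _) = ⊥-elim (<⇒≱ lo (≤-trans (m≤m+n 2 4) (+-mono-≤ 3≤h 3≤h)))
  window-start (suc N) next-regime with regimeOf N
  ... | _ , regime =
    trans (proj₂ (window regime (window-start N regime))) (transition-phase (regime-transition regime next-regime))

  no-clash : ∀ x → scan x ≢ clash
  no-clash x = subst (_≢ clash) (cong scan (sym (m≡m%n+[m/n]*n x a)))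
    (proj₁ (window regime (window-start (x / a) regime)) (x % a) (<⇒≤ (m%n<n x a)))
    where regime = proj₂ (regimeOf (x / a))

  member-step : ∀ {x} → member x ≡ true → member (h + h + suc x) ≡ true
  member-step {x} m =
    subst (λ y → member y ≡ true) (sym (+-suc (h + h) x)) (∈G⇒member (gen-add (here refl) (member⇒∈G m)))

  open Enumeration (∈G⇒member gen-zero) (h + h) member-step

  generator-member : ∀ s → s ∈ a ∷ 2 + a ∷ 4 + a ∷ [] → member s ≡ true
  generator-member s s∈ = ∈G⇒member (subst G (+-identityʳ s) (gen-add s∈ gen-zero))

  first-gap : ∀ z → 0 < z → z < a → member z ≡ false
  first-gap z 0<z z<a = trans (cong member (sym (+-identityʳ z))) (trans (member-window 0 z<a)
    (parity-cases {λ q → inWindow 0 z ≡ nothing q} z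
      (λ e → even-outside {0} {z} e (≤∧≢⇒< 0<z (λ 1≡z → case trans (cong parity 1≡z) e of λ ())))
      (λ e → odd-outside {0} {z} z≤n e)))

  second-window-gap : ∀ t → suc t < a → parity (suc t) ≡ 1ℙ → member (suc (t + a)) ≡ false
  second-window-gap t t<a e =
    trans (cong (λ u → member (suc (t + u))) (sym (+-identityʳ a))) (trans (member-window 1 t<a)
      (odd-outside {1} {suc t} (m≤n+m 4 (h + h)) e))

  skip-one : ∀ {x} → member (suc x) ≡ false → member (2 + x) ≡ true → NextMember x (2 + x)
  skip-one {x} gap m = m , s≤s (n≤1+n x) , λ z x<z z<2+x →
    subst (λ u → member u ≡ false) (≤-antisym x<z (s≤s⁻¹ z<2+x)) gap

  enum-1 : enum 1 ≡ a
  enum-1 = next-unique (enum-next 0) (generator-member a (here refl) , s≤s z≤n , first-gap)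

  enum-2 : enum 2 ≡ 2 + a
  enum-2 = next-unique (subst (λ x → NextMember x (enum 2)) enum-1 (enum-next 1))
    (skip-one (second-window-gap 0 (<-trans (s≤s (s≤s z≤n)) 3<a) refl) (generator-member (2 + a) (there (here refl))))

  enum-3 : enum 3 ≡ 4 + a
  enum-3 = next-unique (subst (λ x → NextMember x (enum 3)) enum-2 (enum-next 2))
    (skip-one (second-window-gap 2 3<a refl) (generator-member (4 + a) (there (there (here refl)))))

  generated : G ≐ ⟨ tabulate {n = 3} (λ (j : Fin 3) → enum (suc (toℕ j))) ⟩
  generated = subst (λ S → G ≐ ⟨ S ⟩) (sym (cong₂ _∷_ enum-1 (cong₂ _∷_ enum-2 (cong₂ _∷_ enum-3 refl))))
    (λ _ → mk⇔ id id)

  permutation : IsPermutationNumericalSemigroup 3 G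
  permutation =
    (⟨⟩-isSubmonoid _ , suc h * a , conductor) ,
    enum ,
    (enum-< , (λ i → member⇒∈G (enum-member i)) , (λ _ x∈G → enum-surjective (∈G⇒member x∈G))) ,
    generated ,
    triple-residues no-clash

lemma4p4 : (k : ℕ) → 1 ≤ k →
    IsPermutationNumericalSemigroup 3 ⟨ 6 * k + 1 ∷ 6 * k + 3 ∷ 6 * k + 5 ∷ [] ⟩
lemma4p4 k k≥1 = subst (λ S → IsPermutationNumericalSemigroup 3 ⟨ S ⟩) generators (permutation k k≥1)
  where
    6k+1 : ∀ k → suc (3 * k + 3 * k) ≡ 6 * k + 1
    6k+1 = solve-∀
    6k+3 : ∀ k → 2 + suc (3 * k + 3 * k) ≡ 6 * k + 3
    6k+3 = solve-∀
    6k+5 : ∀ k → 4 + suc (3 * k + 3 * k) ≡ 6 * k + 5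
    6k+5 = solve-∀
    generators : suc (3 * k + 3 * k) ∷ 2 + suc (3 * k + 3 * k) ∷ 4 + suc (3 * k + 3 * k) ∷ []
               ≡ 6 * k + 1 ∷ 6 * k + 3 ∷ 6 * k + 5 ∷ []
    generators = cong₂ _∷_ (6k+1 k) (cong₂ _∷_ (6k+3 k) (cong₂ _∷_ (6k+5 k) refl))
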